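{- Let $\ell\ge 1$ and let $G$ be a (simple) bipartite graph with sides $U,W$, and assume that there exist distinct vertices $u_1,\ldots,u_{2\ell-1}\in U$ satisfying $\deg(u_i)\ge\min(i,\ell)$ for all $i\le 2\ell-1$. Then $\Psi(L(G))\ge \ell$.
   Context: $L(G)$ is the line graph of $G$: its vertices are the edges of $G$, two being adjacent if they share an endpoint. For a graph $\Gamma$ and an edge $e$ of $\Gamma$, $\Gamma-e$ is the graph obtained by deleting the edge $e$, and $\Gamma*e$ is the graph obtained by deleting both endpoints of $e$ together with all their neighbours (and all incident edges). The value $\Psi(\Gamma)\in\mathbb{Z}_{\ge 0}\cup\{\infty\}$ is defined recursively: $\Psi(\Gamma)=\infty$ if $\Gamma$ has an isolated vertex; $\Psi(\Gamma)=0$ if $\Gamma$ has no vertices; otherwise $\Psi(\Gamma)=\max_{e\in E(\Gamma)}\min\bigl(\Psi(\Gamma-e),\,\Psi(\Gamma*e)+1\bigr)$. (Equivalently, it is the value of Meshulam's game: CON repeatedly picks an edge $e$, NON either deletes $e$ or "explodes" it, replacing the graph by $\Gamma*e$; CON's payoff is $\infty$ if an isolated vertex ever appears, and otherwise the number of explosions once all vertices are gone.) -}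

module Defs where

open import Data.Bool using (Bool; true; false; not; _∧_; _∨_; if_then_else_)
open import Data.Nat as ℕ using (ℕ; zero; suc)
open import Data.Fin using (Fin; _≟_)
open import Data.Bool.ListAction using (any)
open import Data.List using (List; []; _∷_; length; filterᵇ; null; cartesianProduct; allFin; foldr)
open import Data.Product using (_×_; _,_; proj₁; proj₂)
open import Data.Product.Properties using (≡-dec)
open import Relation.Nullary.Decidable using (⌊_⌋)
open import Relation.Binary.Definitions using (DecidableEquality)

data ℕ∞ : Set where
  fin : ℕ → ℕ∞
  ∞   : ℕ∞

suc∞ : ℕ∞ → ℕ∞
suc∞ (fin n) = fin (suc n)
suc∞ ∞       = ∞

min∞ : ℕ∞ → ℕ∞ → ℕ∞
min∞ (fin m) (fin n) = fin (m ℕ.⊓ n)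
min∞ (fin m) ∞       = fin m
min∞ ∞       y       = y

max∞ : ℕ∞ → ℕ∞ → ℕ∞
max∞ (fin m) (fin n) = fin (m ℕ.⊔ n)
max∞ (fin m) ∞       = ∞
max∞ ∞       y       = ∞

data _≤∞_ : ℕ∞ → ℕ∞ → Set where
  fin≤fin : ∀ {m n} → m ℕ.≤ n → fin m ≤∞ fin n
  _≤∞∞    : ∀ x → x ≤∞ ∞

-- V : list of vertices, E : list of edges; an edge (x , y) is read as
-- the unordered pair {x , y} (both orientations may be listed; this
-- does not affect Ψ).

record Graph (A : Set) : Set where
  constructor graph
  field
    V : List A
    E : List (A × A)
open Graph public

module GraphOps {A : Set} (_≟A_ : DecidableEquality A) where

  _==_ : A → A → Bool
  x == y = ⌊ x ≟A y ⌋

  inc : A → A × A → Bool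
  inc v (x , y) = (v == x) ∨ (v == y)

  sameEdge : A × A → A × A → Bool
  sameEdge (a , b) (x , y) = ((a == x) ∧ (b == y)) ∨ ((a == y) ∧ (b == x))

  deleteEdge : A × A → Graph A → Graph A
  deleteEdge e Γ = graph (V Γ) (filterᵇ (λ f → not (sameEdge e f)) (E Γ))

  killed : Graph A → A × A → A → Bool
  killed Γ (a , b) v =
    (v == a) ∨ (v == b) ∨ any (λ f → inc v f ∧ (inc a f ∨ inc b f)) (E Γ)

  explode : A × A → Graph A → Graph A
  explode e Γ =
    graph (filterᵇ (λ v → not (killed Γ e v)) (V Γ))
          (filterᵇ (λ f → not (killed Γ e (proj₁ f)) ∧ not (killed Γ e (proj₂ f))) (E Γ))

  hasIsolated : Graph A → Bool
  hasIsolated Γ = any (λ v → not (any (inc v) (E Γ))) (V Γ)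

  -- maximum over a list (the list is nonempty whenever it is used)
  maxOver : List (A × A) → (A × A → ℕ∞) → ℕ∞
  maxOver es g = foldr (λ e acc → max∞ (g e) acc) (fin 0) es

  -- Ψ with an explicit recursion bound; every recursive call strictly
  -- decreases the number of listed edges, so fuel = length (E Γ) suffices.
  Ψ-fuel : ℕ → Graph A → ℕ∞
  Ψ-fuel fuel Γ =
    if hasIsolated Γ then ∞ else
    (if null (V Γ) then fin 0 else step fuel)
    where
      step : ℕ → ℕ∞
      step zero    = fin 0   -- unreachable (a vertex, none isolated, but no edge)
      step (suc k) = maxOver (E Γ)
        (λ e → min∞ (Ψ-fuel k (deleteEdge e Γ)) (suc∞ (Ψ-fuel k (explode e Γ))))

  Ψ : Graph A → ℕ∞
  Ψ Γ = Ψ-fuel (length (E Γ)) Γ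

record BipGraph (p q : ℕ) : Set where
  constructor bip
  field
    adj : Fin p → Fin q → Bool
open BipGraph public

degU : ∀ {p q} → BipGraph p q → Fin p → ℕ
degU {q = q} G u = length (filterᵇ (λ w → adj G u w) (allFin q))

edgesOf : ∀ {p q} → BipGraph p q → List (Fin p × Fin q)
edgesOf {p} {q} G = filterᵇ (λ e → adj G (proj₁ e) (proj₂ e)) (cartesianProduct (allFin p) (allFin q))

edge-≟ : ∀ {p q} → DecidableEquality (Fin p × Fin q)
edge-≟ = ≡-dec _≟_ _≟_

-- Line graph: vertices = edges of G; two distinct edges adjacent iff
-- they share an endpoint (each adjacency listed in both orientations).
lineGraph : ∀ {p q} → BipGraph p q → Graph (Fin p × Fin q)
lineGraph G = graph es
  (filterᵇ (λ ef → not (⌊ edge-≟ (proj₁ ef) (proj₂ ef) ⌋) ∧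
                   (⌊ proj₁ (proj₁ ef) ≟ proj₁ (proj₂ ef) ⌋ ∨ ⌊ proj₂ (proj₁ ef) ≟ proj₂ (proj₂ ef) ⌋))
           (cartesianProduct es es))
  where es = edgesOf G

ΨL : ∀ {p q} → BipGraph p q → ℕ∞
ΨL G = GraphOps.Ψ edge-≟ (lineGraph G)

-- Let x = u₁w₀ be an edge of G at u₁; CON only ever offers line-edges at x,
-- so if NON deletes all of them x becomes isolated and Ψ = ∞.  While x still has a neighbour
-- y = u′w₀ in its own column, CON offers xy: exploding it kills only edges of G meeting u₁, u′
-- or w₀.  Otherwise every neighbour of x lies in the row u₁, and offering xy with y = u₁w* kills
-- only edges meeting u₁ or w*.  Since every deleted line-edge contains x, which is killed, the
-- exploded graph is exactly L(G′) for G′ = G minus the killed edges.  Dropping u₁ and u′ (or an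
-- arbitrary second vertex) from the sequence leaves 2ℓ − 3 distinct vertices, each moved at least
-- one place forward and with degree dropped by at most one (only the edge to w* can be lost),
-- which is the hypothesis for ℓ − 1.

module Submission where

open import Defs
open import Data.Bool using (Bool; true; false; not; _∧_; _∨_; T)
open import Data.Bool.Properties using (T-∧; T-∨; T-≡; ∧-comm; ∧-identityʳ; ∧-zeroʳ)
open import Data.Bool.ListAction using (any)
open import Data.Fin using (Fin; toℕ; zero; suc; _≟_; punchIn)
open import Data.Fin.Properties using (suc-injective; punchIn-injective; punchInᵢ≢i; any?)
open import Data.List using (List; []; _∷_; _++_; map; length; filterᵇ; null; cartesianProduct; allFin)
open import Data.List.Properties using (filter-++; filter-≐; filter-all; filter-notAll)
open import Data.List.Relation.Unary.All as All using (All; []; _∷_)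
open import Data.List.Relation.Unary.AllPairs using (_∷_)
open import Data.List.Relation.Unary.Any using (here; there)
open import Data.List.Relation.Unary.Any.Properties using (any⁺; any⁻)
open import Data.List.Relation.Unary.Unique.Propositional using (Unique)
import Data.List.Relation.Unary.Unique.Propositional.Properties as Unique
open import Data.List.Membership.Propositional using (_∈_; find; lose)
open import Data.List.Membership.Propositional.Properties
  using (∈-filter⁺; ∈-filter⁻; ∈-cartesianProduct⁺; ∈-allFin; ∈-length)
import Data.List.Membership.DecPropositional as DecMembership
open import Data.Nat using (ℕ; zero; suc; _+_; _*_; _∸_; _⊓_; _≤_; _<_; z≤n; s≤s)
open import Data.Nat.Properties
  using (module ≤-Reasoning; ≤-refl; ≤-trans; ≤-reflexive; ≤-pred; n≤1+n; +-suc; +-comm; +-identityʳ; +-monoʳ-≤; ⊓-monoˡ-≤; ⊓-glb; m≤n⇒m≤n⊔o; m≤n⇒m≤o⊔n)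
open import Data.Product using (Σ; ∃; _×_; _,_; proj₁; proj₂; swap)
open import Data.Product.Properties using (≡-dec)
open import Data.Sum as Sum using (_⊎_; inj₁; inj₂)
open import Data.Unit using (tt)
open import Function using (_∘_)
open import Function.Bundles using (module Equivalence)
open import Function.Definitions using (Injective)
open import Relation.Binary.Definitions using (DecidableEquality)
open import Relation.Binary.PropositionalEquality
open import Relation.Nullary using (¬_; Dec; yes; no; contradiction)
open import Relation.Nullary.Decidable using (⌊_⌋; toWitness; fromWitness; T?; _⊎-dec_)

open Equivalence using (to; from)

¬T⇒T-not : ∀ {b} → ¬ T b → T (not b)
¬T⇒T-not {false} _ = tt
¬T⇒T-not {true} ¬t = ¬t tt

T⇒¬T-not : ∀ {b} → T b → ¬ T (not b)
T⇒¬T-not {true} _ ()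

private variable
  A B : Set

filterᵇ-filterᵇ : (p q : A → Bool) (xs : List A) →
                  filterᵇ p (filterᵇ q xs) ≡ filterᵇ (λ x → q x ∧ p x) xs
filterᵇ-filterᵇ p q [] = refl
filterᵇ-filterᵇ p q (x ∷ xs) with q x
... | false = filterᵇ-filterᵇ p q xs
... | true with p x
...   | true  = cong (x ∷_) (filterᵇ-filterᵇ p q xs)
...   | false = filterᵇ-filterᵇ p q xs

filterᵇ-cong : {p q : A → Bool} → (∀ x → p x ≡ q x) → (xs : List A) → filterᵇ p xs ≡ filterᵇ q xs
filterᵇ-cong {p = p} {q = q} p≗q = filter-≐ (T? ∘ p) (T? ∘ q) ((λ {x} → subst T (p≗q x)) , (λ {x} → subst T (sym (p≗q x))))

filterᵇ-map : (p : B → Bool) (f : A → B) (xs : List A) →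
              filterᵇ p (map f xs) ≡ map f (filterᵇ (λ x → p (f x)) xs)
filterᵇ-map p f [] = refl
filterᵇ-map p f (x ∷ xs) with p (f x)
... | true  = cong (f x ∷_) (filterᵇ-map p f xs)
... | false = filterᵇ-map p f xs

filterᵇ-false : (xs : List A) → filterᵇ (λ _ → false) xs ≡ []
filterᵇ-false [] = refl
filterᵇ-false (x ∷ xs) = filterᵇ-false xs

_×ᵇ_ : (A → Bool) → (B → Bool) → A × B → Bool
(a ×ᵇ b) e = a (proj₁ e) ∧ b (proj₂ e)

cartesianProduct-filterᵇ : (a : A → Bool) (b : B → Bool) (xs : List A) (ys : List B) →
  cartesianProduct (filterᵇ a xs) (filterᵇ b ys) ≡ filterᵇ (a ×ᵇ b) (cartesianProduct xs ys)
cartesianProduct-filterᵇ a b [] ys = refl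
cartesianProduct-filterᵇ a b (x ∷ xs) ys with a x in ax
... | true = begin
    map (x ,_) (filterᵇ b ys) ++ cartesianProduct (filterᵇ a xs) (filterᵇ b ys)
      ≡⟨ cong₂ _++_ (sym row) (cartesianProduct-filterᵇ a b xs ys) ⟩
    filterᵇ (a ×ᵇ b) (map (x ,_) ys) ++ filterᵇ (a ×ᵇ b) (cartesianProduct xs ys)
      ≡⟨ filter-++ (T? ∘ (a ×ᵇ b)) (map (x ,_) ys) (cartesianProduct xs ys) ⟨
    filterᵇ (a ×ᵇ b) (map (x ,_) ys ++ cartesianProduct xs ys) ∎
  where
  open ≡-Reasoning
  row : filterᵇ (a ×ᵇ b) (map (x ,_) ys) ≡ map (x ,_) (filterᵇ b ys)
  row = trans (filterᵇ-map (a ×ᵇ b) (x ,_) ys) (cong (map (x ,_)) (filterᵇ-cong (λ y → cong (_∧ b y) ax) ys))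
... | false = begin
    cartesianProduct (filterᵇ a xs) (filterᵇ b ys)
      ≡⟨ cartesianProduct-filterᵇ a b xs ys ⟩
    filterᵇ (a ×ᵇ b) (cartesianProduct xs ys)
      ≡⟨ cong (_++ filterᵇ (a ×ᵇ b) (cartesianProduct xs ys)) row ⟨
    filterᵇ (a ×ᵇ b) (map (x ,_) ys) ++ filterᵇ (a ×ᵇ b) (cartesianProduct xs ys)
      ≡⟨ filter-++ (T? ∘ (a ×ᵇ b)) (map (x ,_) ys) (cartesianProduct xs ys) ⟨
    filterᵇ (a ×ᵇ b) (map (x ,_) ys ++ cartesianProduct xs ys) ∎
  where
  open ≡-Reasoning
  row : filterᵇ (a ×ᵇ b) (map (x ,_) ys) ≡ []
  row = trans (filterᵇ-map (a ×ᵇ b) (x ,_) ys)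
              (cong (map (x ,_)) (trans (filterᵇ-cong (λ y → cong (_∧ b y) ax) ys) (filterᵇ-false ys)))

length-filterᵇ-≤-+ : (p k : A → Bool) (xs : List A) →
  length (filterᵇ p xs) ≤ length (filterᵇ (λ x → p x ∧ not (k x)) xs) + length (filterᵇ k xs)
length-filterᵇ-≤-+ p k [] = z≤n
length-filterᵇ-≤-+ p k (x ∷ xs) with p x | k x | length-filterᵇ-≤-+ p k xs
... | true  | true  | ih = ≤-trans (s≤s ih) (≤-reflexive (sym (+-suc _ _)))
... | true  | false | ih = s≤s ih
... | false | true  | ih = ≤-trans ih (+-monoʳ-≤ _ (n≤1+n _))
... | false | false | ih = ih

length-≤1 : ∀ {x : A} {xs} → Unique xs → All (_≡ x) xs → length xs ≤ 1
length-≤1 {xs = []} _ _ = z≤n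
length-≤1 {xs = _ ∷ []} _ _ = s≤s z≤n
length-≤1 ((a≢b ∷ _) ∷ _) (refl ∷ refl ∷ _) = contradiction refl a≢b

length-filterᵇ-≤1 : (k : A → Bool) {x : A} {xs : List A} → Unique xs →
                    (∀ y → T (k y) → y ≡ x) → length (filterᵇ k xs) ≤ 1
length-filterᵇ-≤1 k {xs = xs} unique k⇒≡ =
  length-≤1 (Unique.filter⁺ (T? ∘ k) unique)
            (All.tabulate λ y∈ → k⇒≡ _ (proj₂ (∈-filter⁻ (T? ∘ k) {xs = xs} y∈)))

filterᵇ-nonempty : (p : A → Bool) (xs : List A) → 0 < length (filterᵇ p xs) → ∃ λ x → T (p x)
filterᵇ-nonempty p (x ∷ xs) nonempty with p x in px
... | true  = x , subst T (sym px) tt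
... | false = filterᵇ-nonempty p xs nonempty

[1+m]+[1+m]≤1+n⇒m+m<n : ∀ m n → suc m + suc m ≤ suc n → m + m < n
[1+m]+[1+m]≤1+n⇒m+m<n m n (s≤s le) = subst (_≤ n) (+-suc m m) le

toℕ≤toℕ-punchIn : ∀ {n} (i : Fin (suc n)) (j : Fin n) → toℕ j ≤ toℕ (punchIn i j)
toℕ≤toℕ-punchIn zero j = n≤1+n (toℕ j)
toℕ≤toℕ-punchIn (suc i) zero = z≤n
toℕ≤toℕ-punchIn (suc i) (suc j) = s≤s (toℕ≤toℕ-punchIn i j)

fin0≤∞ : ∀ x → fin 0 ≤∞ x
fin0≤∞ (fin n) = fin≤fin z≤n
fin0≤∞ ∞ = _ ≤∞∞

≤∞-max∞ˡ : ∀ {z x} y → z ≤∞ x → z ≤∞ max∞ x y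
≤∞-max∞ˡ (fin y) (fin≤fin z≤x) = fin≤fin (m≤n⇒m≤n⊔o y z≤x)
≤∞-max∞ˡ ∞ (fin≤fin _) = _ ≤∞∞
≤∞-max∞ˡ y (_ ≤∞∞) = _ ≤∞∞

≤∞-max∞ʳ : ∀ {z} x {y} → z ≤∞ y → z ≤∞ max∞ x y
≤∞-max∞ʳ (fin x) (fin≤fin z≤y) = fin≤fin (m≤n⇒m≤o⊔n x z≤y)
≤∞-max∞ʳ (fin x) (_ ≤∞∞) = _ ≤∞∞
≤∞-max∞ʳ ∞ _ = _ ≤∞∞

≤∞-min∞ : ∀ {z x y} → z ≤∞ x → z ≤∞ y → z ≤∞ min∞ x y
≤∞-min∞ (fin≤fin z≤x) (fin≤fin z≤y) = fin≤fin (⊓-glb z≤x z≤y)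
≤∞-min∞ (fin≤fin z≤x) (_ ≤∞∞) = fin≤fin z≤x
≤∞-min∞ (_ ≤∞∞) z≤y = z≤y

suc∞-mono : ∀ {m x} → fin m ≤∞ x → fin (suc m) ≤∞ suc∞ x
suc∞-mono (fin≤fin m≤n) = fin≤fin (s≤s m≤n)
suc∞-mono (_ ≤∞∞) = _ ≤∞∞

module GraphProperties {A : Set} (_≟A_ : DecidableEquality A) where

  open GraphOps _≟A_

  ==-refl : ∀ x → T (x == x)
  ==-refl x = fromWitness {a? = x ≟A x} refl

  ==⇒≡ : ∀ {x y} → T (x == y) → x ≡ y
  ==⇒≡ {x} {y} = toWitness {a? = x ≟A y}

  inc⇒endpoint : ∀ {v s t} → T (inc v (s , t)) → v ≡ s ⊎ v ≡ t
  inc⇒endpoint t with to T-∨ t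
  ... | inj₁ v≡s = inj₁ (==⇒≡ v≡s)
  ... | inj₂ v≡t = inj₂ (==⇒≡ v≡t)

  sameEdge⇒≡ : ∀ {e f} → T (sameEdge e f) → f ≡ e ⊎ f ≡ swap e
  sameEdge⇒≡ {a , b} {x , y} t with to T-∨ t
  ... | inj₁ t′ with to T-∧ t′
  ...   | a≡x , b≡y with ==⇒≡ a≡x | ==⇒≡ b≡y
  ...     | refl | refl = inj₁ refl
  sameEdge⇒≡ {a , b} {x , y} t | inj₂ t′ with to T-∧ t′
  ...   | a≡y , b≡x with ==⇒≡ a≡y | ==⇒≡ b≡x
  ...     | refl | refl = inj₂ refl

  sameEdge-refl : ∀ e → T (sameEdge e e)
  sameEdge-refl (a , b) = from T-∨ (inj₁ (from T-∧ (==-refl a , ==-refl b)))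

  Adjacent : Graph A → A → A → Set
  Adjacent Γ v w = (v , w) ∈ E Γ ⊎ (w , v) ∈ E Γ

  Linked : Graph A → A → A → Set
  Linked Γ v w = v ≡ w ⊎ Adjacent Γ v w

  edgeOf : ∀ {Γ v w} → Adjacent Γ v w → A × A
  edgeOf {v = v} {w} (inj₁ _) = v , w
  edgeOf {v = v} {w} (inj₂ _) = w , v

  edgeOf-∈ : ∀ {Γ v w} (vw : Adjacent Γ v w) → edgeOf {Γ} vw ∈ E Γ
  edgeOf-∈ (inj₁ vw∈) = vw∈
  edgeOf-∈ (inj₂ wv∈) = wv∈

  incident⇒Adjacent : ∀ {Γ v} → T (any (inc v) (E Γ)) → ∃ λ w → Adjacent Γ w v
  incident⇒Adjacent {Γ} incident with find (any⁻ _ (E Γ) incident)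
  ... | (s , t) , st∈ , inc-v with inc⇒endpoint inc-v
  ...   | inj₁ refl = t , inj₂ st∈
  ...   | inj₂ refl = s , inj₁ st∈

  killed-endpointˡ : ∀ Γ a b → T (killed Γ (a , b) a)
  killed-endpointˡ Γ a b = from T-∨ (inj₁ (==-refl a))

  killed-endpointʳ : ∀ Γ a b → T (killed Γ (a , b) b)
  killed-endpointʳ Γ a b = from (T-∨ {b == a}) (inj₂ (from (T-∨ {b == b}) (inj₁ (==-refl b))))

  incident-both⇒Linked : ∀ {Γ f v w} → f ∈ E Γ → T (inc v f) → T (inc w f) → Linked Γ v w
  incident-both⇒Linked {f = s , t} f∈ inc-v inc-w with inc⇒endpoint inc-v | inc⇒endpoint inc-w
  ... | inj₁ refl | inj₁ refl = inj₁ refl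
  ... | inj₁ refl | inj₂ refl = inj₂ (inj₁ f∈)
  ... | inj₂ refl | inj₁ refl = inj₂ (inj₂ f∈)
  ... | inj₂ refl | inj₂ refl = inj₁ refl

  killed⇒Linked : ∀ Γ {a b v} → T (killed Γ (a , b) v) → Linked Γ v a ⊎ Linked Γ v b
  killed⇒Linked Γ t with to T-∨ t
  ... | inj₁ v≡a = inj₁ (inj₁ (==⇒≡ v≡a))
  ... | inj₂ t′ with to T-∨ t′
  ...   | inj₁ v≡b = inj₂ (inj₁ (==⇒≡ v≡b))
  ...   | inj₂ t″ with find (any⁻ _ (E Γ) t″)
  ...     | f , f∈ , inc-vf∧ with to T-∧ inc-vf∧
  ...       | inc-v , inc-a∨b with to T-∨ inc-a∨b
  ...         | inj₁ inc-a = inj₁ (incident-both⇒Linked {Γ} f∈ inc-v inc-a)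
  ...         | inj₂ inc-b = inj₂ (incident-both⇒Linked {Γ} f∈ inc-v inc-b)

  killed-edgeOf⇒Linked : ∀ Γ {v w u} (vw : Adjacent Γ v w) →
                         T (killed Γ (edgeOf {Γ} vw) u) → Linked Γ u v ⊎ Linked Γ u w
  killed-edgeOf⇒Linked Γ (inj₁ _) k = killed⇒Linked Γ k
  killed-edgeOf⇒Linked Γ (inj₂ _) k = Sum.swap (killed⇒Linked Γ k)

  deleteEdge-shrinks : ∀ Γ {e} → e ∈ E Γ → length (E (deleteEdge e Γ)) < length (E Γ)
  deleteEdge-shrinks Γ {e} e∈ =
    filter-notAll (T? ∘ λ f → not (sameEdge e f)) (E Γ) (lose e∈ (T⇒¬T-not (sameEdge-refl e)))

  explode-shrinks : ∀ Γ {e} → e ∈ E Γ → length (E (explode e Γ)) < length (E Γ)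
  explode-shrinks Γ {a , b} e∈ =
    filter-notAll (T? ∘ _) (E Γ) (lose e∈ (T⇒¬T-not (killed-endpointˡ Γ a b) ∘ proj₁ ∘ to T-∧))

  Ψ-fuel-isolated : ∀ k Γ {v} → v ∈ V Γ → ¬ T (any (inc v) (E Γ)) → Ψ-fuel k Γ ≡ ∞
  Ψ-fuel-isolated k Γ v∈ not-incident
    rewrite to T-≡ (any⁺ (λ v → not (any (inc v) (E Γ))) (lose v∈ (¬T⇒T-not not-incident))) = refl

  maxOver-≥ : ∀ {z e} es (g : A × A → ℕ∞) → e ∈ es → z ≤∞ g e → z ≤∞ maxOver es g
  maxOver-≥ (e ∷ es) g (here refl) z≤ = ≤∞-max∞ˡ _ z≤
  maxOver-≥ (e ∷ es) g (there e∈) z≤ = ≤∞-max∞ʳ (g e) (maxOver-≥ es g e∈ z≤)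

  null-∈ : ∀ {x : A} {xs} → x ∈ xs → null xs ≡ false
  null-∈ (here _) = refl
  null-∈ (there _) = refl

  Ψ-fuel-suc-≥ : ∀ {m} k Γ {v e} → v ∈ V Γ → e ∈ E Γ →
                 fin (suc m) ≤∞ Ψ-fuel k (deleteEdge e Γ) → fin m ≤∞ Ψ-fuel k (explode e Γ) →
                 fin (suc m) ≤∞ Ψ-fuel (suc k) Γ
  Ψ-fuel-suc-≥ k Γ v∈ e∈ deleted exploded with hasIsolated Γ
  ... | true = _ ≤∞∞
  ... | false rewrite null-∈ v∈ = maxOver-≥ (E Γ) _ e∈ (≤∞-min∞ deleted (suc∞-mono exploded))

module _ {p q : ℕ} where

  _∖_ : BipGraph p q → (Fin p × Fin q → Bool) → BipGraph p q
  G ∖ K = bip (λ a b → adj G a b ∧ not (K (a , b)))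

  neighbour : (G : BipGraph p q) (a : Fin p) → 1 ≤ degU G a → ∃ λ w → T (adj G a w)
  neighbour G a = filterᵇ-nonempty (adj G a) (allFin q)

  degU-∖ : (G : BipGraph p q) (K : Fin p × Fin q → Bool) (a : Fin p) (w* : Fin q) →
           (∀ w → T (K (a , w)) → w ≡ w*) → degU G a ≤ suc (degU (G ∖ K) a)
  degU-∖ G K a w* only-w* = begin
    degU G a                                                      ≤⟨ length-filterᵇ-≤-+ (adj G a) Ka (allFin q) ⟩
    degU (G ∖ K) a + length (filterᵇ Ka (allFin q))               ≤⟨ +-monoʳ-≤ (degU (G ∖ K) a)
                                                                       (length-filterᵇ-≤1 Ka (Unique.allFin⁺ q) only-w*) ⟩
    degU (G ∖ K) a + 1                                            ≡⟨ +-comm (degU (G ∖ K) a) 1 ⟩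
    suc (degU (G ∖ K) a)                                          ∎
    where
    open ≤-Reasoning
    Ka : Fin q → Bool
    Ka w = K (a , w)

  -- Positions are 0-based, and ℓ + ℓ ≤ suc n says n ≥ 2ℓ − 1 without truncated subtraction.
  record Staircase (G : BipGraph p q) (ℓ n : ℕ) : Set where
    field
      vertex    : Fin n → Fin p
      injective : Injective _≡_ _≡_ vertex
      long      : ℓ + ℓ ≤ suc n
      steep     : ∀ i → suc (toℕ i) ⊓ ℓ ≤ degU G (vertex i)

  open Staircase

  IncidentTo : Fin p → Fin p → Fin q → Fin p × Fin q → Set
  IncidentTo a a′ b e = proj₁ e ≡ a ⊎ proj₁ e ≡ a′ ⊎ proj₂ e ≡ b

  Staircase-∖ : ∀ {G m n} (s : Staircase G (suc m) (suc n)) {K u′ w*} →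
                (∀ e → T (K e) → IncidentTo (vertex s zero) u′ w* e) → ∃ (Staircase (G ∖ K) m)
  Staircase-∖ {m = zero} s _ = 0 , record
    { vertex = λ () ; injective = λ { {()} } ; long = z≤n ; steep = λ () }
  Staircase-∖ {m = suc m} {zero} s _ =
    contradiction ([1+m]+[1+m]≤1+n⇒m+m<n (suc m) 1 (long s)) λ { (s≤s ()) }
  Staircase-∖ {G} {suc m} {suc n} s {K} {u′} {w*} incident = n , record
    { vertex    = remaining
    ; injective = punchIn-injective r _ _ ∘ suc-injective ∘ injective s
    ; long      = ≤-pred ([1+m]+[1+m]≤1+n⇒m+m<n (suc m) (suc (suc n)) (long s))
    ; steep     = steep′
    }
    where
    skipped : Σ (Fin (suc n)) λ r → ∀ i → vertex s (suc i) ≡ u′ → i ≡ r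
    skipped with any? (λ i → vertex s (suc i) ≟ u′)
    ... | yes (r , eq) = r , λ i eq′ → suc-injective (injective s (trans eq′ (sym eq)))
    ... | no none = zero , λ i eq → contradiction (i , eq) none

    r : Fin (suc n)
    r = proj₁ skipped

    remaining : Fin n → Fin p
    remaining j = vertex s (suc (punchIn r j))

    only-w* : ∀ j w → T (K (remaining j , w)) → w ≡ w*
    only-w* j w k with incident (remaining j , w) k
    ... | inj₁ eq = contradiction (injective s eq) λ ()
    ... | inj₂ (inj₁ eq) = contradiction (proj₂ skipped _ eq) (punchInᵢ≢i r j)
    ... | inj₂ (inj₂ eq) = eq

    steep′ : ∀ j → suc (toℕ j) ⊓ suc m ≤ degU (G ∖ K) (remaining j)
    steep′ j = ≤-pred (begin
      suc (suc (toℕ j)) ⊓ suc (suc m)              ≤⟨ ⊓-monoˡ-≤ (suc (suc m)) (s≤s (s≤s (toℕ≤toℕ-punchIn r j))) ⟩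
      suc (toℕ (suc (punchIn r j))) ⊓ suc (suc m)  ≤⟨ steep s (suc (punchIn r j)) ⟩
      degU G (remaining j)                         ≤⟨ degU-∖ G K (remaining j) w* (only-w* j) ⟩
      suc (degU (G ∖ K) (remaining j))             ∎)
      where open ≤-Reasoning

  open GraphOps (edge-≟ {p} {q})
  open GraphProperties (edge-≟ {p} {q})
  open DecMembership (≡-dec (edge-≟ {p} {q}) (edge-≟ {p} {q})) using (_∈?_)

  Edge : Set
  Edge = Fin p × Fin q

  ShareEndpoint : Edge → Edge → Set
  ShareEndpoint e f = proj₁ e ≡ proj₁ f ⊎ proj₂ e ≡ proj₂ f

  isLineEdge : Edge × Edge → Bool
  isLineEdge ef = not (⌊ edge-≟ (proj₁ ef) (proj₂ ef) ⌋) ∧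
                  (⌊ proj₁ (proj₁ ef) ≟ proj₁ (proj₂ ef) ⌋ ∨ ⌊ proj₂ (proj₁ ef) ≟ proj₂ (proj₂ ef) ⌋)

  module LineSubgraph (G : BipGraph p q) where

    L[_] : (Edge × Edge → Bool) → Graph Edge
    L[ D ] = graph (edgesOf G) (filterᵇ D (E (lineGraph G)))

    L-all : L[ (λ _ → true) ] ≡ lineGraph G
    L-all = cong (graph (edgesOf G)) (filter-all (T? ∘ λ _ → true) (All.universal (λ _ → tt) _))

    ∈L⇒isLineEdge : ∀ {D h} → h ∈ E L[ D ] → T (isLineEdge h)
    ∈L⇒isLineEdge {D} h∈ =
      proj₂ (∈-filter⁻ (T? ∘ isLineEdge) {xs = cartesianProduct (edgesOf G) (edgesOf G)}
                       (proj₁ (∈-filter⁻ (T? ∘ D) {xs = E (lineGraph G)} h∈)))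

    ∈L⇒ShareEndpoint : ∀ {D e f} → (e , f) ∈ E L[ D ] → ShareEndpoint e f
    ∈L⇒ShareEndpoint {D} {e} {f} ef∈ with to T-∨ (proj₂ (to T-∧ (∈L⇒isLineEdge {D} ef∈)))
    ... | inj₁ same₁ = inj₁ (toWitness {a? = proj₁ e ≟ proj₁ f} same₁)
    ... | inj₂ same₂ = inj₂ (toWitness {a? = proj₂ e ≟ proj₂ f} same₂)

    Linked⇒ShareEndpoint : ∀ {D v w} → Linked L[ D ] v w → ShareEndpoint v w
    Linked⇒ShareEndpoint (inj₁ refl) = inj₁ refl
    Linked⇒ShareEndpoint (inj₂ (inj₁ vw∈)) = ∈L⇒ShareEndpoint vw∈
    Linked⇒ShareEndpoint (inj₂ (inj₂ wv∈)) = Sum.map sym sym (∈L⇒ShareEndpoint wv∈)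

    L-deleteEdge : ∀ D g → deleteEdge g L[ D ] ≡ L[ (λ h → D h ∧ not (sameEdge g h)) ]
    L-deleteEdge D g = cong (graph (edgesOf G)) (filterᵇ-filterᵇ (λ h → not (sameEdge g h)) D (E (lineGraph G)))

    L-explode : ∀ D g → (∀ h → ¬ T (D h) → T (killed L[ D ] g (proj₁ h)) ⊎ T (killed L[ D ] g (proj₂ h))) →
                explode g L[ D ] ≡ lineGraph (G ∖ killed L[ D ] g)
    L-explode D g deleted-killed = cong₂ graph vertices edges
      where
      open ≡-Reasoning
      es : List Edge
      es = edgesOf G
      cp : List (Edge × Edge)
      cp = cartesianProduct es es
      K : Edge → Bool
      K = killed L[ D ] g

      alive : Edge → Bool
      alive v = not (K v)

      bothAlive : Edge × Edge → Bool
      bothAlive = alive ×ᵇ alive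

      vertices : filterᵇ alive es ≡ edgesOf (G ∖ K)
      vertices = filterᵇ-filterᵇ alive (λ e → adj G (proj₁ e) (proj₂ e)) (cartesianProduct (allFin p) (allFin q))

      killed⇒¬bothAlive : ∀ h → T (K (proj₁ h)) ⊎ T (K (proj₂ h)) → bothAlive h ≡ false
      killed⇒¬bothAlive h (inj₁ k) rewrite to T-≡ k = refl
      killed⇒¬bothAlive h (inj₂ k) rewrite to T-≡ k = ∧-zeroʳ _

      survives : ∀ h → (isLineEdge h ∧ D h) ∧ bothAlive h ≡ bothAlive h ∧ isLineEdge h
      survives h with D h in Dh
      ... | true  = trans (cong (_∧ bothAlive h) (∧-identityʳ (isLineEdge h))) (∧-comm (isLineEdge h) (bothAlive h))
      ... | false = trans (cong (_∧ bothAlive h) (∧-zeroʳ (isLineEdge h)))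
                          (cong (_∧ isLineEdge h) (sym (killed⇒¬bothAlive h (deleted-killed h (subst T Dh)))))

      edges : filterᵇ bothAlive (filterᵇ D (filterᵇ isLineEdge cp)) ≡ E (lineGraph (G ∖ K))
      edges = begin
        filterᵇ bothAlive (filterᵇ D (filterᵇ isLineEdge cp))
          ≡⟨ cong (filterᵇ bothAlive) (filterᵇ-filterᵇ D isLineEdge cp) ⟩
        filterᵇ bothAlive (filterᵇ (λ h → isLineEdge h ∧ D h) cp)
          ≡⟨ filterᵇ-filterᵇ bothAlive _ cp ⟩
        filterᵇ (λ h → (isLineEdge h ∧ D h) ∧ bothAlive h) cp
          ≡⟨ filterᵇ-cong survives cp ⟩
        filterᵇ (λ h → bothAlive h ∧ isLineEdge h) cp
          ≡⟨ filterᵇ-filterᵇ isLineEdge bothAlive cp ⟨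
        filterᵇ isLineEdge (filterᵇ bothAlive cp)
          ≡⟨ cong (filterᵇ isLineEdge) (cartesianProduct-filterᵇ alive alive es es) ⟨
        filterᵇ isLineEdge (cartesianProduct (filterᵇ alive es) (filterᵇ alive es))
          ≡⟨ cong (λ vs → filterᵇ isLineEdge (cartesianProduct vs vs)) vertices ⟩
        E (lineGraph (G ∖ K)) ∎

  module Strategy
    {m : ℕ}
    (IH : ∀ (H : BipGraph p q) {n} → Staircase H m n →
          ∀ k → length (E (lineGraph H)) ≤ k → fin m ≤∞ Ψ-fuel k (lineGraph H))
    (G : BipGraph p q) {n : ℕ} (s : Staircase G (suc m) (suc n))
    {w₀ : Fin q} (adj₀ : T (adj G (vertex s zero) w₀))
    where

    open LineSubgraph G

    u₁ : Fin p
    u₁ = vertex s zero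

    x : Edge
    x = u₁ , w₀

    x∈ : x ∈ edgesOf G
    x∈ = ∈-filter⁺ (T? ∘ λ e → adj G (proj₁ e) (proj₂ e)) (∈-cartesianProduct⁺ (∈-allFin u₁) (∈-allFin w₀)) adj₀

    AtX : Edge × Edge → Set
    AtX h = proj₁ h ≡ x ⊎ proj₂ h ≡ x

    DeletedAtX : (Edge × Edge → Bool) → Set
    DeletedAtX D = ∀ h → ¬ T (D h) → AtX h

    record Move (D : Edge × Edge → Bool) : Set where
      field
        {end} : Edge
        spoke : Adjacent L[ D ] end x
        {u′}  : Fin p
        {w*}  : Fin q
        kills : ∀ v → Linked L[ D ] v end ⊎ Linked L[ D ] v x → IncidentTo u₁ u′ w* v

    spoke? : ∀ D y → Dec (Adjacent L[ D ] y x)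
    spoke? D y = ((y , x) ∈? E L[ D ]) ⊎-dec ((x , y) ∈? E L[ D ])

    spoke-row : ∀ {D v} → ¬ (∃ λ a → Adjacent L[ D ] (a , w₀) x) → Adjacent L[ D ] v x → proj₁ v ≡ u₁
    spoke-row {D} {a , b} none vx with Linked⇒ShareEndpoint {D} (inj₂ vx)
    ... | inj₁ a≡u₁ = a≡u₁
    ... | inj₂ refl = contradiction (a , vx) none

    move : ∀ D → T (any (inc x) (E L[ D ])) → Move D
    move D incident with any? (λ a → spoke? D (a , w₀))
    ... | yes (a , ax) = record { spoke = ax ; kills = column }
      where
      column : ∀ v → Linked L[ D ] v (a , w₀) ⊎ Linked L[ D ] v x → IncidentTo u₁ a w₀ v
      column v (inj₁ va) = Sum.[ inj₂ ∘ inj₁ , inj₂ ∘ inj₂ ] (Linked⇒ShareEndpoint {D} va)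
      column v (inj₂ vx) = Sum.[ inj₁ , inj₂ ∘ inj₂ ] (Linked⇒ShareEndpoint {D} vx)
    ... | no none with incident⇒Adjacent {L[ D ]} incident
    ...   | y , yx = record { spoke = yx ; kills = row }
      where
      row : ∀ v → Linked L[ D ] v y ⊎ Linked L[ D ] v x → IncidentTo u₁ u₁ (proj₂ y) v
      row v (inj₁ vy) = Sum.[ inj₁ ∘ (λ v₁≡y₁ → trans v₁≡y₁ (spoke-row none yx)) , inj₂ ∘ inj₂ ]
                              (Linked⇒ShareEndpoint {D} vy)
      row v (inj₂ (inj₁ refl)) = inj₁ refl
      row v (inj₂ (inj₂ vx)) = inj₁ (spoke-row none vx)

    edgeOf-AtX : ∀ {D y} (yx : Adjacent L[ D ] y x) → AtX (edgeOf {L[ D ]} yx)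
    edgeOf-AtX (inj₁ _) = inj₂ refl
    edgeOf-AtX (inj₂ _) = inj₁ refl

    killed-x : ∀ {D g} → AtX g → T (killed L[ D ] g x)
    killed-x {D} {a , b} (inj₁ refl) = killed-endpointˡ L[ D ] a b
    killed-x {D} {a , b} (inj₂ refl) = killed-endpointʳ L[ D ] a b

    deleted-killed : ∀ {D g} → DeletedAtX D → AtX g →
                     ∀ h → ¬ T (D h) → T (killed L[ D ] g (proj₁ h)) ⊎ T (killed L[ D ] g (proj₂ h))
    deleted-killed {D} {g} deletedAtX atX h ¬Dh =
      Sum.map kill kill (deletedAtX h ¬Dh)
      where
      kill : ∀ {v} → v ≡ x → T (killed L[ D ] g v)
      kill refl = killed-x atX

    deleteEdge-DeletedAtX : ∀ {D g} → DeletedAtX D → AtX g → DeletedAtX (λ h → D h ∧ not (sameEdge g h))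
    deleteEdge-DeletedAtX {D} {g} deletedAtX atX h deleted with D h in Dh | sameEdge g h in same
    ... | false | _     = deletedAtX h (subst T Dh)
    ... | true  | false = contradiction tt deleted
    ... | true  | true with sameEdge⇒≡ {g} {h} (subst T (sym same) tt)
    ...   | inj₁ refl = atX
    ...   | inj₂ refl = Sum.swap atX

    mutual
      strategy : ∀ k D → DeletedAtX D → length (E L[ D ]) ≤ k → fin (suc m) ≤∞ Ψ-fuel k L[ D ]
      strategy k D deletedAtX size with T? (any (inc x) (E L[ D ]))
      ... | no isolated = subst (fin (suc m) ≤∞_) (sym (Ψ-fuel-isolated k L[ D ] x∈ isolated)) (_ ≤∞∞)
      ... | yes incident = play k D deletedAtX size (move D incident)

      play : ∀ k D → DeletedAtX D → length (E L[ D ]) ≤ k → Move D → fin (suc m) ≤∞ Ψ-fuel k L[ D ]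
      play zero D _ size mv = contradiction (≤-trans (∈-length (edgeOf-∈ {L[ D ]} (Move.spoke mv))) size) λ ()
      play (suc k) D deletedAtX size mv = Ψ-fuel-suc-≥ k L[ D ] x∈ g∈ deleted exploded
        where
        open Move mv
        g : Edge × Edge
        g = edgeOf {L[ D ]} spoke
        g∈ : g ∈ E L[ D ]
        g∈ = edgeOf-∈ spoke
        atX : AtX g
        atX = edgeOf-AtX spoke

        within : ∀ {Γ Γ′} → Γ ≡ Γ′ → length (E Γ) < length (E L[ D ]) → length (E Γ′) ≤ k
        within refl shrinks = ≤-pred (≤-trans shrinks size)

        deletion : deleteEdge g L[ D ] ≡ L[ (λ h → D h ∧ not (sameEdge g h)) ]
        deletion = L-deleteEdge D g

        explosion : explode g L[ D ] ≡ lineGraph (G ∖ killed L[ D ] g)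
        explosion = L-explode D g (deleted-killed deletedAtX atX)

        deleted : fin (suc m) ≤∞ Ψ-fuel k (deleteEdge g L[ D ])
        deleted = subst (λ Γ → fin (suc m) ≤∞ Ψ-fuel k Γ) (sym deletion)
          (strategy k _ (deleteEdge-DeletedAtX deletedAtX atX) (within deletion (deleteEdge-shrinks L[ D ] g∈)))

        exploded : fin m ≤∞ Ψ-fuel k (explode g L[ D ])
        exploded = subst (λ Γ → fin m ≤∞ Ψ-fuel k Γ) (sym explosion)
          (IH _ (proj₂ (Staircase-∖ s λ e k → kills e (killed-edgeOf⇒Linked L[ D ] spoke k)))
             k (within explosion (explode-shrinks L[ D ] g∈)))

  Ψ-fuel-lineGraph-≥ : ∀ ℓ (G : BipGraph p q) {n} → Staircase G ℓ n →
                       ∀ k → length (E (lineGraph G)) ≤ k → fin ℓ ≤∞ Ψ-fuel k (lineGraph G)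
  Ψ-fuel-lineGraph-≥ zero G s k _ = fin0≤∞ _
  Ψ-fuel-lineGraph-≥ (suc m) G {zero} s = contradiction ([1+m]+[1+m]≤1+n⇒m+m<n m 0 (long s)) λ ()
  Ψ-fuel-lineGraph-≥ (suc m) G {suc n} s k size with neighbour G (vertex s zero) (steep s zero)
  ... | w₀ , adj₀ =
    subst (λ Γ → fin (suc m) ≤∞ Ψ-fuel k Γ) L-all
      (Strategy.strategy (Ψ-fuel-lineGraph-≥ m) G s adj₀ k (λ _ → true) (λ _ ¬tt → contradiction tt ¬tt)
        (subst (λ Γ → length (E Γ) ≤ k) (sym L-all) size))
    where open LineSubgraph G using (L-all)

lemma3p1 : (ℓ p q : ℕ) → 1 ≤ ℓ → (G : BipGraph p q)
  → (u : Fin (2 * ℓ ∸ 1) → Fin p) → Injective _≡_ _≡_ u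
  → (∀ i → (suc (toℕ i) ⊓ ℓ) ≤ degU G (u i))
  → fin ℓ ≤∞ ΨL G
lemma3p1 ℓ@(suc m) p q _ G u u-injective u-steep = Ψ-fuel-lineGraph-≥ ℓ G staircase _ ≤-refl
  where
  staircase : Staircase G ℓ (2 * ℓ ∸ 1)
  staircase = record
    { vertex    = u
    ; injective = u-injective
    -- as ℓ is a successor, suc (2 * ℓ ∸ 1) computes to ℓ + (ℓ + 0)
    ; long      = ≤-reflexive (cong (ℓ +_) (sym (+-identityʳ ℓ)))
    ; steep     = u-steep
    }
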